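{- The schema $\boxdot\phi\to\boxdot\boxdot\phi$ is not valid on the class of transitive bimodal frames: there exist a bimodal model $\mathcal{M}=\langle S,R_1,R_2,V\rangle$ with $R_1$ and $R_2$ transitive, a point $s\in S$ and a formula $\phi\in\mathcal{L}(\boxdot)$ such that $\mathcal{M},s\nvDash\boxdot\phi\to\boxdot\boxdot\phi$.
   Context: Fix a nonempty set $\mathbf{P}$ of propositional variables; $\mathcal{L}(\boxdot)$ is given by $\phi::=p\mid\neg\phi\mid(\phi\land\phi)\mid\boxdot\phi$, $p\in\mathbf{P}$. A bimodal model is $\langle S,R_1,R_2,V\rangle$ with $S$ nonempty, $R_1,R_2\subseteq S\times S$, $V:\mathbf{P}\to\mathcal{P}(S)$. $\mathcal{M},s\vDash\boxdot\phi$ iff for all $t,u$ with $sR_1t$ and $sR_2u$, $(\mathcal{M},t\vDash\phi\iff\mathcal{M},u\vDash\phi)$; Boolean clauses as usual. -}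

module Defs where

open import Data.Product using (_×_)
open import Relation.Nullary using (¬_)
open import Function.Bundles using (_⇔_)

data Form (P : Set) : Set where
  var  : P → Form P
  neg  : Form P → Form P
  _∧ᶠ_ : Form P → Form P → Form P
  ⊡    : Form P → Form P

_⇒ᶠ_ : {P : Set} → Form P → Form P → Form P
φ ⇒ᶠ ψ = neg (φ ∧ᶠ neg ψ)

-- Bimodal models ⟨S, R₁, R₂, V⟩; S nonempty (witness given).
record Model (P : Set) : Set₁ where
  field
    S     : Set
    point : S
    R₁    : S → S → Set
    R₂    : S → S → Set
    V     : P → S → Set

Transitive : {S : Set} → (S → S → Set) → Set
Transitive {S} R = ∀ {x y z : S} → R x y → R y z → R x z

_,_⊨_ : {P : Set} (M : Model P) → Model.S M → Form P → Set
M , s ⊨ var p    = Model.V M p s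
M , s ⊨ neg φ    = ¬ (M , s ⊨ φ)
M , s ⊨ (φ ∧ᶠ ψ) = (M , s ⊨ φ) × (M , s ⊨ ψ)
M , s ⊨ ⊡ φ      = ∀ t u → Model.R₁ M s t → Model.R₂ M s u →
                     ((M , t ⊨ φ) ⇔ (M , u ⊨ φ))

module Submission where

-- Idea: ⊡φ at s only compares φ at the R₁-successors with φ at the
-- R₂-successors of s, whereas ⊡⊡φ compares ⊡φ there, and ⊡φ looks one step
-- further.  We build a five-point model on s, a, b, c, d with
--     s R₁ a,  b R₁ c,      s R₂ b,  s R₂ d,  b R₂ d,
-- both relations transitive, and p true only at c.  Then p is false at every
-- successor of s, so ⊡p holds at s; but ⊡p holds vacuously at the R₁-dead
-- end a and fails at b (p is true at c and false at d), so ⊡⊡p fails at s.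

open import Defs
open import Data.Product using (Σ; _×_; ∃-syntax; _,_)
open import Relation.Nullary using (¬_)
open import Data.Unit using (⊤; tt)
open import Data.Empty using (⊥; ⊥-elim)
open import Function.Bundles using (mk⇔; Equivalence)

module Semantics {P : Set} (M : Model P) where
  open Model M

  ⇒ᶠ-refuted : ∀ {s} (φ ψ : Form P) →
    M , s ⊨ φ → ¬ (M , s ⊨ ψ) → ¬ (M , s ⊨ (φ ⇒ᶠ ψ))
  ⇒ᶠ-refuted _ _ holds fails impl = impl (holds , fails)

  ⊡-of-uniformly-false : ∀ {s} (φ : Form P) →
    (∀ {t} → R₁ s t → ¬ (M , t ⊨ φ)) → (∀ {u} → R₂ s u → ¬ (M , u ⊨ φ)) →
    M , s ⊨ ⊡ φ
  ⊡-of-uniformly-false _ false₁ false₂ t u st su =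
    mk⇔ (λ φt → ⊥-elim (false₁ st φt)) (λ φu → ⊥-elim (false₂ su φu))

  ⊡-at-R₁-dead-end : ∀ {s} (φ : Form P) → (∀ {t} → ¬ R₁ s t) → M , s ⊨ ⊡ φ
  ⊡-at-R₁-dead-end _ deadEnd t u st _ = ⊥-elim (deadEnd st)

  ⊡-refuted : ∀ {s t u} (φ : Form P) → R₁ s t → R₂ s u →
    M , t ⊨ φ → ¬ (M , u ⊨ φ) → ¬ (M , s ⊨ ⊡ φ)
  ⊡-refuted {t = t} {u} _ st su φt ¬φu box =
    ¬φu (Equivalence.to (box t u st su) φt)

data Point : Set where
  s a b c d : Point

-- R₁ : s → a and b → c; no R₁-path has length two, so R₁ is transitive.
data R₁ : Point → Point → Set where
  s→a : R₁ s a
  b→c : R₁ b c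

-- R₂ : s → b → d together with the transitive shortcut s → d.
data R₂ : Point → Point → Set where
  s→b : R₂ s b
  b→d : R₂ b d
  s→d : R₂ s d

R₁-transitive : Transitive R₁
R₁-transitive s→a ()
R₁-transitive b→c ()

R₂-transitive : Transitive R₂
R₂-transitive s→b b→d = s→d
R₂-transitive b→d ()
R₂-transitive s→d ()

onlyAtC : Point → Set
onlyAtC c = ⊤
onlyAtC _ = ⊥

countermodel : (P : Set) → Model P
countermodel P = record
  { S = Point ; point = s ; R₁ = R₁ ; R₂ = R₂ ; V = λ _ → onlyAtC }

module Countermodel {P : Set} (p : P) where
  open Semantics (countermodel P)

  M : Model P
  M = countermodel P

  ⊡p-at-s : M , s ⊨ ⊡ (var p)
  ⊡p-at-s = ⊡-of-uniformly-false (var p) (λ { s→a () }) (λ { s→b () ; s→d () })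

  ⊡p-at-a : M , a ⊨ ⊡ (var p)
  ⊡p-at-a = ⊡-at-R₁-dead-end (var p) (λ ())

  ¬⊡p-at-b : ¬ (M , b ⊨ ⊡ (var p))
  ¬⊡p-at-b = ⊡-refuted (var p) b→c b→d tt (λ ())

  ¬⊡⊡p-at-s : ¬ (M , s ⊨ ⊡ (⊡ (var p)))
  ¬⊡⊡p-at-s = ⊡-refuted (⊡ (var p)) s→a s→b ⊡p-at-a ¬⊡p-at-b

  schema-fails : ¬ (M , s ⊨ (⊡ (var p) ⇒ᶠ ⊡ (⊡ (var p))))
  schema-fails = ⇒ᶠ-refuted (⊡ (var p)) (⊡ (⊡ (var p))) ⊡p-at-s ¬⊡⊡p-at-s

proposition7p32 : (P : Set) → P →
    Σ (Model P) λ M → Transitive (Model.R₁ M) × Transitive (Model.R₂ M) ×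
    (∃[ s ] ∃[ φ ] ¬ (M , s ⊨ (⊡ φ ⇒ᶠ ⊡ (⊡ φ))))
proposition7p32 P p =
  countermodel P , R₁-transitive , R₂-transitive , s , var p , schema-fails
  where open Countermodel p
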